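{- Let $u_n=(-1)^{s_2(n)}$, where $s_2(n)$ is the sum of the binary digits of $n$. Then $$\prod_{n=1}^\infty\left(\frac{(4n-1)(2n+1)}{(4n+1)(2n-1)}\right)^{u_n}=\frac 12.$$ -}

module Defs where

open import Data.Nat as ℕ using (ℕ; zero; suc; _+_; _*_; _%_; _/_)
open import Data.Integer using (+_)
open import Data.Rational as ℚ using (ℚ)

-- Binary digit sum s₂(n). The fuel argument (initialised to n) only ensures
-- structural recursion; since ⌊n/2⌋ < n for n ≥ 1, fuel n always suffices.
s₂-fuel : ℕ → ℕ → ℕ
s₂-fuel zero    n = 0
s₂-fuel (suc f) zero = 0
s₂-fuel (suc f) n@(suc _) = n % 2 + s₂-fuel f (n / 2)

s₂ : ℕ → ℕ
s₂ n = s₂-fuel n n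

-- u n = (-1)^{s₂ n}: +1 iff s₂ n is even (s₂ n % 2 = 0), else -1.

-- The factor ((4n-1)(2n+1)/((4n+1)(2n-1)))^{u_n}, for n = suc k ≥ 1:
-- 4n-1 = 4k+3, 2n+1 = 2k+3, 4n+1 = 4k+5, 2n-1 = 2k+1.
factor : ℕ → ℚ
factor k with s₂ (suc k) % 2
... | zero  = (+ ((4 * k + 3) * (2 * k + 3))) ℚ./ suc ((4 * k + 4) * (2 * k + 1) + 2 * k)
... | suc _ = (+ ((4 * k + 5) * (2 * k + 1))) ℚ./ suc ((4 * k + 2) * (2 * k + 3) + 2 * k + 2)

partialProduct : ℕ → ℚ
partialProduct zero    = ℚ.1ℚ
partialProduct (suc N) = partialProduct N ℚ.* factor N

module Submission where

-- Index the factors by k = n - 1: the k-th one is F k = e k · G k with e k = (4n-1)/(4n+1) and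
-- G k = (2n+1)/(2n-1); put g k = 2n/(2n+1) and P_h(N) = ∏_{k<N} h(k)^{u_{k+1}}.  As u_{2j} = u_j
-- and u_{2j+1} = -u_j, grouping the terms 2j+1, 2j+2 of P_h(2m+1) gives a signed product of
-- h(2j+1)/h(2j+2); for h = G·g this is g/e, whence the exact identities
--   2 P_F(2m+1) = (P_e(2m+1)/P_e(m)) (P_g(m)/P_g(2m+1)),  and similarly for 2 P_F(2m+2).
-- Each quotient is a signed product over a window [a, b) of an increasing sequence h ≤ 1;
-- pairing terms of opposite sign puts it between h(a)³ and h(a)⁻³.  With e(a), g(a) ≥ x/(x+1)
-- and Bernoulli's inequality, 2 P_F(N) is within the factor 1 - 6/(x+1) of 1 for N ∈ {2x+1, 2x+2}.
-- Positive rationals are pairs (numerator , denominator) of naturals, identities are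
-- cross-multiplied; only the last step compares with Defs.partialProduct through ℚᵘ.

open import Defs
open import Algebra.Bundles using (CommutativeMonoid)
import Algebra.Solver.CommutativeMonoid as CommutativeMonoidSolver
open import Data.Nat using (ℕ; zero; suc; _+_; _*_; _∸_; _≤_; _<_; _≥_; _≤?_; z≤n; s≤s; _%_; _/_; pred; >-nonZero)
open import Data.Nat.Properties
open import Algebra.Properties.CommutativeSemigroup *-commutativeSemigroup
  using (interchange; x∙yz≈yx∙z; xy∙z≈y∙xz; x∙yz≈z∙yx; xy∙z≈xz∙y)
open import Data.Nat.DivMod using (m/n<m; m*n%n≡0; m*n/n≡m; [m+kn]%n≡m%n; +-distrib-/)
open import Data.Nat.Tactic.RingSolver using (solve-∀)
open import Data.Integer as ℤ using (+_; +[1+_]; -[1+_]; +<+; _⊖_)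
open import Data.Integer.Properties using (∣⊖∣-≤; ∣m⊖n∣≡∣n⊖m∣; pos-*; -1*i≡-i; m-n≡m⊖n)
open import Data.Rational as ℚ using (ℚ; mkℚ; 0ℚ; toℚᵘ)
open import Data.Rational.Properties
  using (toℚᵘ-fromℚᵘ; toℚᵘ-homo-*; toℚᵘ-homo-+; toℚᵘ-homo‿-; toℚᵘ-homo-∣-∣; toℚᵘ-cancel-<)
open import Data.Rational.Unnormalised as ℚᵘ using (ℚᵘ; mkℚᵘ; _≃_; *<*)
open import Data.Rational.Unnormalised.Properties as ℚᵘ
  using (≃-refl; ≃-reflexive; ≃-sym; ≃-trans; ∣-∣-cong; <-respˡ-≃)
open import Data.Product using (_×_; _,_; proj₁; proj₂; swap; ∃)
open import Function using (_∘_)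
open import Relation.Binary.PropositionalEquality
open import Relation.Nullary using (yes; no)

Frac : Set
Frac = ℕ × ℕ

one two : Frac
one = 1 , 1
two = 2 , 1

infixl 7 _⊗_
_⊗_ : Frac → Frac → Frac
x ⊗ y = proj₁ x * proj₁ y , proj₂ x * proj₂ y

-- Fractions under ⊗ form a commutative monoid up to ≡; its solver does the regrouping of
-- products below (swap x, the reciprocal, is treated as an atom).
⊗-commutativeMonoid : CommutativeMonoid _ _
⊗-commutativeMonoid = record
  { Carrier = Frac ; _≈_ = _≡_ ; _∙_ = _⊗_ ; ε = one
  ; isCommutativeMonoid = record
    { isMonoid = record
      { isSemigroup = record
        { isMagma = record { isEquivalence = isEquivalence ; ∙-cong = cong₂ _⊗_ }
        ; assoc = λ x y z → cong₂ _,_ (*-assoc (proj₁ x) (proj₁ y) (proj₁ z))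
                                       (*-assoc (proj₂ x) (proj₂ y) (proj₂ z)) }
      ; identity = (λ x → cong₂ _,_ (*-identityˡ (proj₁ x)) (*-identityˡ (proj₂ x)))
                 , (λ x → cong₂ _,_ (*-identityʳ (proj₁ x)) (*-identityʳ (proj₂ x))) }
    ; comm = λ x y → cong₂ _,_ (*-comm (proj₁ x) (proj₁ y)) (*-comm (proj₂ x) (proj₂ y)) } }

open CommutativeMonoidSolver ⊗-commutativeMonoid using (solve; _⊜_; _⊕_)
open CommutativeMonoid ⊗-commutativeMonoid using ()
  renaming (assoc to ⊗-assoc; comm to ⊗-comm; identityˡ to ⊗-identityˡ; identityʳ to ⊗-identityʳ)

-- x ^± τ is x^{(-1)^τ}: the fraction itself for τ = 0 and its reciprocal otherwise.
infixl 8 _^±_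
_^±_ : Frac → ℕ → Frac
x ^± zero  = x
x ^± suc _ = swap x

^±-⊗ : ∀ τ x y → (x ⊗ y) ^± τ ≡ x ^± τ ⊗ y ^± τ
^±-⊗ zero    x y = refl
^±-⊗ (suc _) x y = refl

^±-swap : ∀ τ x → swap x ^± τ ≡ swap (x ^± τ)
^±-swap zero    x = refl
^±-swap (suc _) x = refl

^±-suc : ∀ s x → x ^± (suc s % 2) ≡ swap x ^± (s % 2)
^±-suc zero          x = refl
^±-suc (suc zero)    x = refl
^±-suc (suc (suc s)) x = ^±-suc s x

s₂-fuel-irrelevant : ∀ f f′ n → n ≤ f → n ≤ f′ → s₂-fuel f n ≡ s₂-fuel f′ n
s₂-fuel-irrelevant zero    zero     zero _ _ = refl
s₂-fuel-irrelevant zero    (suc f′) zero _ _ = refl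
s₂-fuel-irrelevant (suc f) zero     zero _ _ = refl
s₂-fuel-irrelevant (suc f) (suc f′) zero _ _ = refl
s₂-fuel-irrelevant (suc f) (suc f′) n@(suc m) (s≤s m≤f) (s≤s m≤f′) =
  cong (λ r → n % 2 + r) (s₂-fuel-irrelevant f f′ (n / 2) (≤-trans half≤m m≤f) (≤-trans half≤m m≤f′))
  where
  half≤m : n / 2 ≤ m
  half≤m = <⇒≤pred (m/n<m n 2 (s≤s (s≤s z≤n)))

s₂-unfold : ∀ n → s₂ (suc n) ≡ suc n % 2 + s₂ (suc n / 2)
s₂-unfold n = cong (λ r → suc n % 2 + r) (s₂-fuel-irrelevant n (suc n / 2) (suc n / 2) half≤n ≤-refl)
  where
  half≤n : suc n / 2 ≤ n
  half≤n = <⇒≤pred (m/n<m (suc n) 2 (s≤s (s≤s z≤n)))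

s₂-double : ∀ n → s₂ (n * 2) ≡ s₂ n
s₂-double zero    = refl
s₂-double (suc n) = begin
  s₂ (suc n * 2)                      ≡⟨ s₂-unfold (suc (n * 2)) ⟩
  suc n * 2 % 2 + s₂ (suc n * 2 / 2)  ≡⟨ cong₂ _+_ (m*n%n≡0 (suc n) 2) (cong s₂ (m*n/n≡m (suc n) 2)) ⟩
  s₂ (suc n)                          ∎
  where open ≡-Reasoning

s₂-double+1 : ∀ n → s₂ (suc (n * 2)) ≡ suc (s₂ n)
s₂-double+1 n = begin
  s₂ (suc (n * 2))                        ≡⟨ s₂-unfold (n * 2) ⟩
  (1 + n * 2) % 2 + s₂ ((1 + n * 2) / 2)  ≡⟨ cong₂ _+_ ([m+kn]%n≡m%n 1 n 2) (cong s₂ halve) ⟩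
  suc (s₂ n)                              ∎
  where
  open ≡-Reasoning
  halve : (1 + n * 2) / 2 ≡ n
  halve = trans (+-distrib-/ 1 (n * 2) (subst (λ r → 1 + r < 2) (sym (m*n%n≡0 n 2)) ≤-refl))
                (m*n/n≡m n 2)

-- The parity of the binary digit sum; u_n = (-1)^{tm n}.
tm : ℕ → ℕ
tm n = s₂ n % 2

tm-double : ∀ n → tm (n * 2) ≡ tm n
tm-double n = cong (_% 2) (s₂-double n)

tm-double+1 : ∀ n x → x ^± tm (suc (n * 2)) ≡ swap x ^± tm n
tm-double+1 n x = trans (cong (λ s → x ^± (s % 2)) (s₂-double+1 n)) (^±-suc (s₂ n) x)

-- A balanced fraction represents 1; x ≋ y says x and y represent the same rational.
Balanced : Frac → Set
Balanced x = proj₁ x ≡ proj₂ x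

infix 4 _≋_
_≋_ : Frac → Frac → Set
x ≋ y = Balanced (x ⊗ swap y)

balanced-⊗ : ∀ {x y} → Balanced x → Balanced y → Balanced (x ⊗ y)
balanced-⊗ = cong₂ _*_

balanced-^± : ∀ τ {x} → Balanced x → Balanced (x ^± τ)
balanced-^± zero    bal = bal
balanced-^± (suc _) bal = sym bal

balanced-self : ∀ x → Balanced (x ⊗ swap x)
balanced-self x = *-comm (proj₁ x) (proj₂ x)

-- signedProd h N = P_h(N); the k-th term carries the sign u_{k+1}.
signedProd : (ℕ → Frac) → ℕ → Frac
signedProd h zero    = one
signedProd h (suc N) = signedProd h N ⊗ h N ^± tm (suc N)

signedProd-⊗ : ∀ h h′ N → signedProd (λ k → h k ⊗ h′ k) N ≡ signedProd h N ⊗ signedProd h′ N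
signedProd-⊗ h h′ zero    = refl
signedProd-⊗ h h′ (suc N) = begin
  signedProd (λ k → h k ⊗ h′ k) N ⊗ (h N ⊗ h′ N) ^± τ
    ≡⟨ cong₂ _⊗_ (signedProd-⊗ h h′ N) (^±-⊗ τ (h N) (h′ N)) ⟩
  (P ⊗ P′) ⊗ (h N ^± τ ⊗ h′ N ^± τ)
    ≡⟨ solve 4 (λ a b c d → (a ⊕ b) ⊕ (c ⊕ d) ⊜ (a ⊕ c) ⊕ (b ⊕ d)) refl P P′ (h N ^± τ) (h′ N ^± τ) ⟩
  (P ⊗ h N ^± τ) ⊗ (P′ ⊗ h′ N ^± τ) ∎
  where
  open ≡-Reasoning
  τ = tm (suc N)
  P = signedProd h N
  P′ = signedProd h′ N

signedProd-swap : ∀ h N → signedProd (swap ∘ h) N ≡ swap (signedProd h N)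
signedProd-swap h zero    = refl
signedProd-swap h (suc N) = cong₂ _⊗_ (signedProd-swap h N) (^±-swap (tm (suc N)) (h N))

signedProd-balanced : ∀ {h} → (∀ k → Balanced (h k)) → ∀ N → Balanced (signedProd h N)
signedProd-balanced bal zero    = refl
signedProd-balanced bal (suc N) = balanced-⊗ (signedProd-balanced bal N) (balanced-^± (tm (suc N)) (bal N))

signedProd-cong : ∀ {h h′} → (∀ k → h k ≋ h′ k) → ∀ N → signedProd h N ≋ signedProd h′ N
signedProd-cong {h} {h′} h≋h′ N =
  subst Balanced (trans (signedProd-⊗ h (swap ∘ h′) N) (cong (signedProd h N ⊗_) (signedProd-swap h′ N)))
        (signedProd-balanced h≋h′ N)

-- The pairing identity: since u_{2j+2} = u_{j+1} = -u_{2j+3}, the terms k = 2j+1 and 2j+2 of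
-- P_h(2m+1) combine to (h(2j+1)/h(2j+2))^{u_{j+1}}; the term k = 0 carries u_1 = -1.
pairUp : (ℕ → Frac) → ℕ → Frac
pairUp h j = h (suc (j * 2)) ⊗ swap (h (suc j * 2))

signedProd-pairs : ∀ h m → signedProd h (suc (m * 2)) ≡ swap (h 0) ⊗ signedProd (pairUp h) m
signedProd-pairs h zero    = ⊗-comm one (swap (h 0))
signedProd-pairs h (suc m) = begin
  signedProd h (suc (m * 2)) ⊗ h (suc (m * 2)) ^± tm (suc m * 2) ⊗ h (suc m * 2) ^± tm (suc (suc m * 2))
    ≡⟨ cong₂ (λ P τ → P ⊗ h (suc (m * 2)) ^± τ ⊗ h (suc m * 2) ^± tm (suc (suc m * 2)))
             (signedProd-pairs h m) (tm-double (suc m)) ⟩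
  swap (h 0) ⊗ Q ⊗ h (suc (m * 2)) ^± σ ⊗ h (suc m * 2) ^± tm (suc (suc m * 2))
    ≡⟨ cong (swap (h 0) ⊗ Q ⊗ h (suc (m * 2)) ^± σ ⊗_) (tm-double+1 (suc m) (h (suc m * 2))) ⟩
  swap (h 0) ⊗ Q ⊗ h (suc (m * 2)) ^± σ ⊗ swap (h (suc m * 2)) ^± σ
    ≡⟨ solve 4 (λ a b c d → ((a ⊕ b) ⊕ c) ⊕ d ⊜ a ⊕ (b ⊕ (c ⊕ d))) refl
         (swap (h 0)) Q (h (suc (m * 2)) ^± σ) (swap (h (suc m * 2)) ^± σ) ⟩
  swap (h 0) ⊗ (Q ⊗ (h (suc (m * 2)) ^± σ ⊗ swap (h (suc m * 2)) ^± σ))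
    ≡⟨ cong (λ p → swap (h 0) ⊗ (Q ⊗ p)) (sym (^±-⊗ σ (h (suc (m * 2))) (swap (h (suc m * 2))))) ⟩
  swap (h 0) ⊗ signedProd (pairUp h) (suc m) ∎
  where
  open ≡-Reasoning
  σ = tm (suc m)
  Q = signedProd (pairUp h) m

-- With n = k + 1:  e k = (4n-1)/(4n+1),  G k = (2n+1)/(2n-1),  g k = 2n/(2n+1), and the
-- k-th factor of the theorem is F k = e k · G k (this is the fraction in Defs.factor).
e G g F : ℕ → Frac
e k = 4 * k + 3 , 4 * k + 5
G k = 2 * k + 3 , 2 * k + 1
g k = 2 * k + 2 , 2 * k + 3
F k = e k ⊗ G k

G⊗g : ℕ → Frac
G⊗g k = G k ⊗ g k

G⊗g-pairs : ∀ j → pairUp G⊗g j ≋ g j ⊗ swap (e j)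
G⊗g-pairs = cross-multiplied
  where
  cross-multiplied : ∀ j →
    (2 * suc (j * 2) + 3) * (2 * suc (j * 2) + 2) * ((2 * (suc j * 2) + 1) * (2 * (suc j * 2) + 3))
      * ((2 * j + 3) * (4 * j + 3))
    ≡ (2 * suc (j * 2) + 1) * (2 * suc (j * 2) + 3) * ((2 * (suc j * 2) + 3) * (2 * (suc j * 2) + 2))
      * ((2 * j + 2) * (4 * j + 5))
  cross-multiplied = solve-∀

-- F(2m+1) = e(2m+1)/e(m), which extends the identity from odd to even lengths.
F-odd : ∀ m → F (suc (m * 2)) ≋ e (suc (m * 2)) ⊗ swap (e m)
F-odd = cross-multiplied
  where
  cross-multiplied : ∀ m →
    (4 * suc (m * 2) + 3) * (2 * suc (m * 2) + 3) * ((4 * suc (m * 2) + 5) * (4 * m + 3))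
    ≡ (4 * suc (m * 2) + 5) * (2 * suc (m * 2) + 1) * ((4 * suc (m * 2) + 3) * (4 * m + 5))
  cross-multiplied = solve-∀

window : (ℕ → Frac) → ℕ → ℕ → Frac
window h a b = signedProd h b ⊗ swap (signedProd h a)

odd-identity : ∀ m → let N = suc (m * 2) in
  two ⊗ signedProd F N ≋ window e m N ⊗ swap (window g m N)
odd-identity m = subst Balanced rearrange (balanced-⊗ G⊗g-balance (balanced-self A))
  where
  N = suc (m * 2)
  A = signedProd e N
  B = signedProd e m
  C = signedProd G N
  D = signedProd g N
  E = signedProd g m
  P = signedProd (pairUp G⊗g) m
  -- P_G(N) P_g(N) = P_{G·g}(N) = (1/2) P_{pairUp (G·g)}(m) = (1/2) P_g(m) / P_e(m)
  G⊗g-balance : Balanced ((C ⊗ D) ⊗ (two ⊗ (swap E ⊗ B)))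
  G⊗g-balance = subst Balanced (sym (begin
      (C ⊗ D) ⊗ (two ⊗ (swap E ⊗ B))
        ≡⟨ cong (_⊗ (two ⊗ (swap E ⊗ B))) (trans (sym (signedProd-⊗ G g N)) (signedProd-pairs G⊗g m)) ⟩
      (swap (G⊗g 0) ⊗ P) ⊗ (two ⊗ (swap E ⊗ B))
        ≡⟨ solve 5 (λ c p t a b → (c ⊕ p) ⊕ (t ⊕ (a ⊕ b)) ⊜ (c ⊕ t) ⊕ (p ⊕ (a ⊕ b))) refl
             (swap (G⊗g 0)) P two (swap E) B ⟩
      (swap (G⊗g 0) ⊗ two) ⊗ (P ⊗ (swap E ⊗ B)) ∎))
    (balanced-⊗ {swap (G⊗g 0) ⊗ two} refl P≋E/B)
    where
    open ≡-Reasoning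
    P≋E/B : P ≋ E ⊗ swap B
    P≋E/B = subst (P ≋_)
      (trans (signedProd-⊗ g (swap ∘ e) m) (cong (E ⊗_) (signedProd-swap e m)))
      (signedProd-cong G⊗g-pairs m)
  rearrange : ((C ⊗ D) ⊗ (two ⊗ (swap E ⊗ B))) ⊗ (A ⊗ swap A)
            ≡ two ⊗ signedProd F N ⊗ swap (window e m N ⊗ swap (window g m N))
  rearrange = trans
    (solve 7 (λ c d t sE b a sA → ((c ⊕ d) ⊕ (t ⊕ (sE ⊕ b))) ⊕ (a ⊕ sA)
                                 ⊜ (t ⊕ (a ⊕ c)) ⊕ ((sA ⊕ b) ⊕ (d ⊕ sE))) refl
       C D two (swap E) B A (swap A))
    (cong (λ x → two ⊗ x ⊗ swap (window e m N ⊗ swap (window g m N))) (sym (signedProd-⊗ e G N)))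

-- 2 P_F(2m+2) = (P_e(2m+2)/P_e(m+1)) · (P_g(m)/P_g(2m+1)): the new factor F(2m+1)^{u_{2m+2}}
-- equals e(2m+1)^{u_{2m+2}} / e(m)^{u_{m+1}} because u_{2m+2} = u_{m+1}.
even-identity : ∀ m → let N = suc (m * 2) in
  two ⊗ signedProd F (suc N) ≋ window e (suc m) (suc N) ⊗ swap (window g m N)
even-identity m = subst Balanced rearrange (balanced-⊗ (odd-identity m) new-terms-balance)
  where
  N = suc (m * 2)
  τ = tm (suc N)
  σ = tm (suc m)
  new-terms-balance : Balanced (F N ^± τ ⊗ (swap (e N ^± τ) ⊗ e m ^± σ))
  new-terms-balance = subst (λ υ → Balanced (F N ^± τ ⊗ (swap (e N ^± τ) ⊗ e m ^± υ))) (tm-double (suc m))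
    (subst Balanced (trans (^±-⊗ τ (F N) (swap (e N) ⊗ e m))
                           (cong (F N ^± τ ⊗_) (trans (^±-⊗ τ (swap (e N)) (e m))
                                                      (cong (_⊗ e m ^± τ) (^±-swap τ (e N))))))
      (balanced-^± τ (F-odd m)))
  rearrange : (two ⊗ signedProd F N ⊗ swap (window e m N ⊗ swap (window g m N)))
                ⊗ (F N ^± τ ⊗ (swap (e N ^± τ) ⊗ e m ^± σ))
            ≡ two ⊗ signedProd F (suc N) ⊗ swap (window e (suc m) (suc N) ⊗ swap (window g m N))
  rearrange = solve 8 (λ t p f sA sa b b′ w → ((t ⊕ p) ⊕ ((sA ⊕ b) ⊕ w)) ⊕ (f ⊕ (sa ⊕ b′))
                                          ⊜ (t ⊕ (p ⊕ f)) ⊕ (((sA ⊕ sa) ⊕ (b ⊕ b′)) ⊕ w)) refl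
    two (signedProd F N) (F N ^± τ) (swap (signedProd e N)) (swap (e N ^± τ)) (signedProd e m) (e m ^± σ)
    (window g m N)

*-positive : ∀ {m n} → 0 < m → 0 < n → 0 < m * n
*-positive {suc _} {suc _} _ _ = s≤s z≤n

0<+suc : ∀ a b → 0 < a + suc b
0<+suc a b = subst (0 <_) (sym (+-suc a b)) (s≤s z≤n)

Positive : Frac → Set
Positive x = 0 < proj₁ x × 0 < proj₂ x

positive-⊗ : ∀ {x y} → Positive x → Positive y → Positive (x ⊗ y)
positive-⊗ (x₁>0 , x₂>0) (y₁>0 , y₂>0) = *-positive x₁>0 y₁>0 , *-positive x₂>0 y₂>0

positive-^± : ∀ τ {x} → Positive x → Positive (x ^± τ)
positive-^± zero    pos = pos
positive-^± (suc _) pos = swap pos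

signedProd-positive : ∀ {h} → (∀ k → Positive (h k)) → ∀ N → Positive (signedProd h N)
signedProd-positive pos zero    = s≤s z≤n , s≤s z≤n
signedProd-positive pos (suc N) = positive-⊗ (signedProd-positive pos N) (positive-^± (tm (suc N)) (pos N))

window-positive : ∀ {h} → (∀ k → Positive (h k)) → ∀ a b → Positive (window h a b)
window-positive {h} pos a b =
  positive-⊗ {signedProd h b} {swap (signedProd h a)}
             (signedProd-positive {h} pos b) (swap (signedProd-positive {h} pos a))

-- x ≤ᶠ y: x is at most y as a rational number.  It is a preorder; transitivity needs the middle
-- denominator to be positive.
infix 4 _≤ᶠ_
data _≤ᶠ_ (x y : Frac) : Set where
  *≤* : proj₁ x * proj₂ y ≤ proj₁ y * proj₂ x → x ≤ᶠ y

≤ᶠ-refl : ∀ x → x ≤ᶠ x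
≤ᶠ-refl x = *≤* ≤-refl

≤ᶠ-trans : ∀ {x y z} → 0 < proj₂ y → x ≤ᶠ y → y ≤ᶠ z → x ≤ᶠ z
≤ᶠ-trans {x₁ , x₂} {y₁ , y₂} {z₁ , z₂} y₂>0 (*≤* x≤y) (*≤* y≤z) =
  *≤* (*-cancelˡ-≤ y₂ {{>-nonZero y₂>0}} (begin
    y₂ * (x₁ * z₂) ≡⟨ x∙yz≈yx∙z y₂ x₁ z₂ ⟩
    x₁ * y₂ * z₂   ≤⟨ *-monoˡ-≤ z₂ x≤y ⟩
    y₁ * x₂ * z₂   ≡⟨ xy∙z≈y∙xz y₁ x₂ z₂ ⟩
    x₂ * (y₁ * z₂) ≤⟨ *-monoʳ-≤ x₂ y≤z ⟩
    x₂ * (z₁ * y₂) ≡⟨ x∙yz≈z∙yx x₂ z₁ y₂ ⟩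
    y₂ * (z₁ * x₂) ∎))
  where open ≤-Reasoning

≤ᶠ-⊗ : ∀ {x y u v} → x ≤ᶠ y → u ≤ᶠ v → x ⊗ u ≤ᶠ y ⊗ v
≤ᶠ-⊗ {x₁ , x₂} {y₁ , y₂} {u₁ , u₂} {v₁ , v₂} (*≤* x≤y) (*≤* u≤v) = *≤* (begin
  x₁ * u₁ * (y₂ * v₂) ≡⟨ interchange x₁ u₁ y₂ v₂ ⟩
  x₁ * y₂ * (u₁ * v₂) ≤⟨ *-mono-≤ x≤y u≤v ⟩
  y₁ * x₂ * (v₁ * u₂) ≡⟨ interchange y₁ x₂ v₁ u₂ ⟩
  y₁ * v₁ * (x₂ * u₂) ∎)
  where open ≤-Reasoning

≤ᶠ-shrink : ∀ x {y} → y ≤ᶠ one → x ⊗ y ≤ᶠ x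
≤ᶠ-shrink x {y} y≤1 = subst (x ⊗ y ≤ᶠ_) (⊗-identityʳ x) (≤ᶠ-⊗ (≤ᶠ-refl x) y≤1)

≤ᶠ-balanced : ∀ x {c} → Balanced c → x ≤ᶠ x ⊗ c
≤ᶠ-balanced (x₁ , x₂) {c₁ , c₂} c₁≡c₂ = *≤* (≤-reflexive (begin
  x₁ * (x₂ * c₂) ≡⟨ cong (λ c → x₁ * (x₂ * c)) (sym c₁≡c₂) ⟩
  x₁ * (x₂ * c₁) ≡⟨ x∙yz≈yx∙z x₁ x₂ c₁ ⟩
  x₂ * x₁ * c₁   ≡⟨ cong (_* c₁) (*-comm x₂ x₁) ⟩
  x₁ * x₂ * c₁   ≡⟨ xy∙z≈xz∙y x₁ x₂ c₁ ⟩
  x₁ * c₁ * x₂   ∎))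
  where open ≡-Reasoning

≤ᶠ⇒ratio≤one : ∀ {x y} → x ≤ᶠ y → x ⊗ swap y ≤ᶠ one
≤ᶠ⇒ratio≤one {x₁ , x₂} {y₁ , y₂} (*≤* x≤y) =
  *≤* (subst₂ _≤_ (sym (*-identityʳ (x₁ * y₂))) (trans (*-comm y₁ x₂) (sym (*-identityˡ (x₂ * y₁)))) x≤y)

≤ᶠ-one-swap : ∀ {x y} → x ≤ᶠ one → y ≤ᶠ one → x ≤ᶠ swap y
≤ᶠ-one-swap {x₁ , x₂} {y₁ , y₂} (*≤* x≤1) (*≤* y≤1) =
  *≤* (subst (x₁ * y₁ ≤_) (*-comm x₂ y₂) (*-mono-≤ (num≤den {x₁} {x₂} x≤1) (num≤den {y₁} {y₂} y≤1)))
  where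
  num≤den : ∀ {a b} → a * 1 ≤ 1 * b → a ≤ b
  num≤den {a} {b} = subst₂ _≤_ (*-identityʳ a) (*-identityˡ b)

infixr 8 _^ᶠ_
_^ᶠ_ : Frac → ℕ → Frac
r ^ᶠ zero  = one
r ^ᶠ suc n = r ⊗ r ^ᶠ n

^ᶠ-+ : ∀ r m n → r ^ᶠ (m + n) ≡ r ^ᶠ m ⊗ r ^ᶠ n
^ᶠ-+ r zero    n = sym (⊗-identityˡ (r ^ᶠ n))
^ᶠ-+ r (suc m) n = trans (cong (r ⊗_) (^ᶠ-+ r m n)) (sym (⊗-assoc r (r ^ᶠ m) (r ^ᶠ n)))

^ᶠ-den>0 : ∀ r → 0 < proj₂ r → ∀ n → 0 < proj₂ (r ^ᶠ n)
^ᶠ-den>0 r r₂>0 zero    = s≤s z≤n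
^ᶠ-den>0 r r₂>0 (suc n) = *-positive r₂>0 (^ᶠ-den>0 r r₂>0 n)

≤ᶠ-^ᶠ : ∀ {x y} → x ≤ᶠ y → ∀ n → x ^ᶠ n ≤ᶠ y ^ᶠ n
≤ᶠ-^ᶠ x≤y zero    = ≤ᶠ-refl one
≤ᶠ-^ᶠ x≤y (suc n) = ≤ᶠ-⊗ x≤y (≤ᶠ-^ᶠ x≤y n)

-- Within r x:  r ≤ x ≤ 1/r, i.e. x differs from 1 by at most the factor 1/r (for r ≤ 1).
record Within (r x : Frac) : Set where
  constructor within
  field
    lower : r ≤ᶠ x
    upper : r ≤ᶠ swap x

within-⊗ : ∀ {r s x y} → Within r x → Within s y → Within (r ⊗ s) (x ⊗ y)
within-⊗ (within r≤x r≤1/x) (within s≤y s≤1/y) = within (≤ᶠ-⊗ r≤x s≤y) (≤ᶠ-⊗ r≤1/x s≤1/y)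

within-swap : ∀ {r x} → Within r x → Within r (swap x)
within-swap (within r≤x r≤1/x) = within r≤1/x r≤x

within-^± : ∀ τ {r x} → Within r x → Within r (x ^± τ)
within-^± zero    w = w
within-^± (suc _) w = within-swap w

within-weaken : ∀ {r′ r x} → r′ ≤ᶠ r → 0 < proj₂ r → Within r x → Within r′ x
within-weaken r′≤r r₂>0 (within r≤x r≤1/x) = within (≤ᶠ-trans r₂>0 r′≤r r≤x) (≤ᶠ-trans r₂>0 r′≤r r≤1/x)

within-one : ∀ {r} → r ≤ᶠ one → Within r one
within-one r≤1 = within r≤1 r≤1

within-self : ∀ {r} → r ≤ᶠ one → Within r r
within-self {r} r≤1 = within (≤ᶠ-refl r) (≤ᶠ-one-swap r≤1 r≤1)

within-one-balanced : ∀ {c} → Balanced c → Within one c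
within-one-balanced {c₁ , c₂} c₁≡c₂ = within
  (*≤* (≤-reflexive (trans (*-identityˡ c₂) (trans (sym c₁≡c₂) (sym (*-identityʳ c₁))))))
  (*≤* (≤-reflexive (trans (*-identityˡ c₁) (trans c₁≡c₂ (sym (*-identityʳ c₂))))))

within-balanced : ∀ {r x c} → Within r x → Balanced c → Within r (x ⊗ c)
within-balanced {r} w bal = subst (λ r′ → Within r′ _) (⊗-identityʳ r) (within-⊗ w (within-one-balanced bal))

within-transfer : ∀ {r x y} → Within r y → x ≋ y → Positive y → Within r x
within-transfer {r} {x₁ , x₂} {y₁ , y₂} (within r≤y r≤1/y) x≋y (y₁>0 , y₂>0) = within
  (≤ᶠ-trans y₂>0 r≤y (*≤* (≤-reflexive (trans (*-comm y₁ x₂) (sym x≋y)))))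
  (≤ᶠ-trans y₁>0 r≤1/y (*≤* (≤-reflexive (trans (*-comm y₂ x₁) x≋y))))

record Increasing (h : ℕ → Frac) : Set where
  field
    positive  : ∀ k → Positive (h k)
    below-one : ∀ k → h k ≤ᶠ one
    monotone  : ∀ {j k} → j ≤ k → h j ≤ᶠ h k

segment : (ℕ → Frac) → ℕ → ℕ → Frac
segment h a zero    = one
segment h a (suc n) = h a ^± tm (suc a) ⊗ segment h (suc a) n

signedProd-split : ∀ h a n → signedProd h (a + n) ≡ signedProd h a ⊗ segment h a n
signedProd-split h a zero    = trans (cong (signedProd h) (+-identityʳ a)) (sym (⊗-identityʳ (signedProd h a)))
signedProd-split h a (suc n) = begin
  signedProd h (a + suc n)                                 ≡⟨ cong (signedProd h) (+-suc a n) ⟩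
  signedProd h (suc a + n)                                 ≡⟨ signedProd-split h (suc a) n ⟩
  signedProd h a ⊗ h a ^± tm (suc a) ⊗ segment h (suc a) n  ≡⟨ ⊗-assoc (signedProd h a) _ _ ⟩
  signedProd h a ⊗ segment h a (suc n)                     ∎
  where open ≡-Reasoning

data Parity : ℕ → Set where
  even : ∀ x → Parity (x * 2)
  odd  : ∀ x → Parity (suc (x * 2))

parity : ∀ n → Parity n
parity zero = even 0
parity (suc n) with parity n
... | even x = odd x
... | odd x  = even (suc x)

module _ {h : ℕ → Frac} (inc : Increasing h) where
  open Increasing inc

  private
    den>0 : ∀ k → 0 < proj₂ (h k)
    den>0 k = proj₂ (positive k)

  within-term : ∀ {j k} → j ≤ k → ∀ τ → Within (h j) (h k ^± τ)
  within-term j≤k τ = within-^± τ (within (monotone j≤k) (≤ᶠ-one-swap (below-one _) (below-one _)))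

  within-pair : ∀ a τ → Within (h a ⊗ swap (h (suc a))) ((h a ⊗ swap (h (suc a))) ^± τ)
  within-pair a τ = within-^± τ (within-self (≤ᶠ⇒ratio≤one (monotone (n≤1+n a))))

  -- (h(a)/h(a+1)) · h(a+2)² ≥ h(a)², because h(a+2) ≥ h(a+1) and h(a+2) ≥ h(a).
  pair-absorb : ∀ a → h a ⊗ h a ≤ᶠ (h a ⊗ swap (h (suc a))) ⊗ (h (suc (suc a)) ⊗ h (suc (suc a)))
  pair-absorb a = ≤ᶠ-trans den>0′ (≤ᶠ-balanced (u ⊗ u) (balanced-self v))
    (subst (_≤ᶠ (u ⊗ swap v) ⊗ (w ⊗ w)) regroup (≤ᶠ-⊗ (≤ᶠ-refl (u ⊗ swap v))
      (≤ᶠ-⊗ (monotone (≤-trans (n≤1+n a) (n≤1+n (suc a)))) (monotone (n≤1+n (suc a))))))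
    where
    u = h a
    v = h (suc a)
    w = h (suc (suc a))
    den>0′ : 0 < proj₂ (u ⊗ u ⊗ (v ⊗ swap v))
    den>0′ = *-positive (*-positive (den>0 a) (den>0 a)) (*-positive (den>0 (suc a)) (proj₁ (positive (suc a))))
    regroup : (u ⊗ swap v) ⊗ (u ⊗ v) ≡ (u ⊗ u) ⊗ (v ⊗ swap v)
    regroup = solve 3 (λ u v v′ → (u ⊕ v′) ⊕ (u ⊕ v) ⊜ (u ⊕ u) ⊕ (v ⊕ v′)) refl u v (swap v)

  -- Starting at an odd index a, the terms pair up as in signedProd-pairs, and the segment is
  -- within h(a)²: each pair costs h(a)/h(a+1), which the bound for the rest absorbs.
  odd-start : ∀ x n → Within (h (suc (x * 2)) ⊗ h (suc (x * 2))) (segment h (suc (x * 2)) n)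
  odd-start x zero          = within-one (≤ᶠ-⊗ (below-one _) (below-one _))
  odd-start x (suc zero)    = within-⊗ (within-term ≤-refl (tm (suc (suc (x * 2))))) (within-one (below-one _))
  odd-start x (suc (suc n)) = subst (Within (h a ⊗ h a)) (sym regroup)
    (within-weaken (pair-absorb a) (*-positive (*-positive (den>0 a) (proj₁ (positive (suc a))))
                                               (*-positive (den>0 (suc (suc a))) (den>0 (suc (suc a)))))
      (within-⊗ (within-pair a σ) (odd-start (suc x) n)))
    where
    a = suc (x * 2)
    σ = tm (suc x)
    S = segment h (suc (suc a)) n
    regroup : segment h a (suc (suc n)) ≡ (h a ⊗ swap (h (suc a))) ^± σ ⊗ S
    regroup = begin
      h a ^± tm (suc a) ⊗ (h (suc a) ^± tm (suc (suc a)) ⊗ S)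
        ≡⟨ cong₂ (λ τ y → h a ^± τ ⊗ (y ⊗ S)) (tm-double (suc x)) (tm-double+1 (suc x) (h (suc a))) ⟩
      h a ^± σ ⊗ (swap (h (suc a)) ^± σ ⊗ S)
        ≡⟨ sym (⊗-assoc (h a ^± σ) _ S) ⟩
      h a ^± σ ⊗ swap (h (suc a)) ^± σ ⊗ S
        ≡⟨ cong (_⊗ S) (sym (^±-⊗ σ (h a) (swap (h (suc a))))) ⟩
      (h a ⊗ swap (h (suc a))) ^± σ ⊗ S ∎
      where open ≡-Reasoning

  -- Every segment starting at a is within h(a)³ (an even start costs one unpaired term).
  segment-bound : ∀ a n → Within (h a ^ᶠ 3) (segment h a n)
  segment-bound a n with parity a
  ... | odd x = within-weaken (≤ᶠ-⊗ (≤ᶠ-refl (h a)) (≤ᶠ-shrink (h a) (≤ᶠ-⊗ (below-one a) (≤ᶠ-refl one))))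
                              (*-positive (den>0 a) (den>0 a)) (odd-start x n)
  segment-bound a zero    | even x = within-one (≤ᶠ-^ᶠ (below-one a) 3)
  segment-bound a (suc n) | even x = within-weaken
    (≤ᶠ-⊗ (≤ᶠ-refl (h a)) (≤ᶠ-⊗ (monotone (n≤1+n a)) (subst (_≤ᶠ h (suc a)) (sym (⊗-identityʳ (h a))) (monotone (n≤1+n a)))))
    (*-positive (den>0 a) (*-positive (den>0 (suc a)) (den>0 (suc a))))
    (within-⊗ (within-term ≤-refl (tm (suc a))) (odd-start x n))

  window-bound : ∀ {a b} → a ≤ b → Within (h a ^ᶠ 3) (window h a b)
  window-bound {a} a≤b with m≤n⇒∃[o]m+o≡n a≤b
  ... | n , refl = subst (Within (h a ^ᶠ 3)) (sym regroup) (within-balanced (segment-bound a n) (balanced-self S))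
    where
    S = signedProd h a
    regroup : window h a (a + n) ≡ segment h a n ⊗ (S ⊗ swap S)
    regroup = trans (cong (_⊗ swap S) (signedProd-split h a n))
      (solve 3 (λ s t s′ → (s ⊕ t) ⊕ s′ ⊜ t ⊕ (s ⊕ s′)) refl S (segment h a n) (swap S))

≤ᶠ-by-gap : ∀ {x y} d → proj₁ y * proj₂ x ≡ proj₁ x * proj₂ y + d → x ≤ᶠ y
≤ᶠ-by-gap {x} {y} d eq = *≤* (subst (proj₁ x * proj₂ y ≤_) (sym eq) (m≤m+n (proj₁ x * proj₂ y) d))

e-increasing : Increasing e
e-increasing = record
  { positive  = λ k → 0<+suc (4 * k) 2 , 0<+suc (4 * k) 4
  ; below-one = λ k → ≤ᶠ-by-gap 2 (below k)
  ; monotone  = mono }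
  where
  below : ∀ k → 1 * (4 * k + 5) ≡ (4 * k + 3) * 1 + 2
  below = solve-∀
  gap : ∀ j r → (4 * (j + r) + 3) * (4 * j + 5) ≡ (4 * j + 3) * (4 * (j + r) + 5) + 8 * r
  gap = solve-∀
  mono : ∀ {j k} → j ≤ k → e j ≤ᶠ e k
  mono {j} j≤k with m≤n⇒∃[o]m+o≡n j≤k
  ... | r , refl = ≤ᶠ-by-gap (8 * r) (gap j r)

g-increasing : Increasing g
g-increasing = record
  { positive  = λ k → 0<+suc (2 * k) 1 , 0<+suc (2 * k) 2
  ; below-one = λ k → ≤ᶠ-by-gap 1 (below k)
  ; monotone  = mono }
  where
  below : ∀ k → 1 * (2 * k + 3) ≡ (2 * k + 2) * 1 + 1
  below = solve-∀
  gap : ∀ j r → (2 * (j + r) + 2) * (2 * j + 3) ≡ (2 * j + 2) * (2 * (j + r) + 3) + 2 * r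
  gap = solve-∀
  mono : ∀ {j k} → j ≤ k → g j ≤ᶠ g k
  mono {j} j≤k with m≤n⇒∃[o]m+o≡n j≤k
  ... | r , refl = ≤ᶠ-by-gap (2 * r) (gap j r)

e-lower : ∀ {x a} → x ≤ a → (x , suc x) ≤ᶠ e a
e-lower {x} x≤a with m≤n⇒∃[o]m+o≡n x≤a
... | r , refl = ≤ᶠ-by-gap (2 * x + 4 * r + 3) (gap x r)
  where
  gap : ∀ x r → (4 * (x + r) + 3) * suc x ≡ x * (4 * (x + r) + 5) + (2 * x + 4 * r + 3)
  gap = solve-∀

g-lower : ∀ x → (x , suc x) ≤ᶠ g x
g-lower x = ≤ᶠ-by-gap (x + 2) (gap x)
  where
  gap : ∀ x → (2 * x + 2) * suc x ≡ x * (2 * x + 3) + (x + 2)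
  gap = solve-∀

doubled-product-within : ∀ {M a b L L′} → two ⊗ signedProd F M ≋ window e a L ⊗ swap (window g b L′) →
  a ≤ L → b ≤ L′ → ∀ {q} → q ≤ᶠ e a → q ≤ᶠ g b → Within (q ^ᶠ 6) (two ⊗ signedProd F M)
doubled-product-within {M} {a} {b} {L} {L′} identity a≤L b≤L′ {q} q≤ea q≤gb =
  within-weaken q⁶≤ea³gb³ (*-positive (^ᶠ-den>0 (e a) (den>0 e-increasing a) 3) (^ᶠ-den>0 (g b) (den>0 g-increasing b) 3))
    (within-transfer (within-⊗ (window-bound e-increasing a≤L) (within-swap (window-bound g-increasing b≤L′)))
      identity
      (positive-⊗ {window e a L} {swap (window g b L′)} (window-positive (Increasing.positive e-increasing) a L)
                  (swap (window-positive (Increasing.positive g-increasing) b L′))))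
  where
  den>0 : ∀ {h} → Increasing h → ∀ k → 0 < proj₂ (h k)
  den>0 inc k = proj₂ (Increasing.positive inc k)
  q⁶≤ea³gb³ : q ^ᶠ 6 ≤ᶠ e a ^ᶠ 3 ⊗ g b ^ᶠ 3
  q⁶≤ea³gb³ = subst (_≤ᶠ e a ^ᶠ 3 ⊗ g b ^ᶠ 3) (sym (^ᶠ-+ q 3 3)) (≤ᶠ-⊗ (≤ᶠ-^ᶠ q≤ea 3) (≤ᶠ-^ᶠ q≤gb 3))

doubled-product-bound : ∀ x → Within ((x , suc x) ^ᶠ 6) (two ⊗ signedProd F (suc (x * 2)))
                            × Within ((x , suc x) ^ᶠ 6) (two ⊗ signedProd F (suc x * 2))
doubled-product-bound x =
  doubled-product-within {suc (x * 2)} {x} {x} {suc (x * 2)} {suc (x * 2)}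
    (odd-identity x) x≤2x+1 x≤2x+1 (e-lower ≤-refl) (g-lower x) ,
  doubled-product-within {suc x * 2} {suc x} {x} {suc x * 2} {suc (x * 2)}
    (even-identity x) (m≤m*n (suc x) 2) x≤2x+1 (e-lower (n≤1+n x)) (g-lower x)
  where
  x≤2x+1 : x ≤ suc (x * 2)
  x≤2x+1 = ≤-trans (m≤m*n x 2) (n≤1+n (x * 2))

bernoulli-step : ∀ k j → (k ∸ j , suc k) ≤ᶠ (k , suc k) ⊗ (suc k ∸ j , suc k)
bernoulli-step k j with j ≤? k
... | no j≰k = *≤* (subst (λ z → z * (suc k * suc k) ≤ k * (suc k ∸ j) * suc k)
                          (sym (m≤n⇒m∸n≡0 (<⇒≤ (≰⇒> j≰k)))) z≤n)
... | yes j≤k with m≤n⇒∃[o]m+o≡n j≤k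
...   | c , refl = *≤* (subst₂ (λ u w → u * (suc (j + c) * suc (j + c)) ≤ (j + c) * w * suc (j + c))
                                (sym (m+n∸m≡n j c)) (sym (trans (cong (_∸ j) (sym (+-suc j c))) (m+n∸m≡n j (suc c))))
                                (subst (c * (suc (j + c) * suc (j + c)) ≤_) (sym (gap j c)) (m≤m+n _ _)))
  where
  gap : ∀ j c → (j + c) * suc c * suc (j + c) ≡ c * (suc (j + c) * suc (j + c)) + j * suc (j + c)
  gap = solve-∀

bernoulli : ∀ k j → (suc k ∸ j , suc k) ≤ᶠ (k , suc k) ^ᶠ j
bernoulli k zero    = *≤* (≤-reflexive (*-comm (suc k) 1))
bernoulli k (suc j) = ≤ᶠ-trans (*-positive {suc k} {suc k} (s≤s z≤n) (s≤s z≤n))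
  (bernoulli-step k j) (≤ᶠ-⊗ (≤ᶠ-refl (k , suc k)) (bernoulli k j))

gap-bound : ∀ {L u v} → L * v ≤ u * (L + 6) → u ≤ v → L * (v ∸ u) ≤ 6 * u
gap-bound {L} {u} lower u≤v with m≤n⇒∃[o]m+o≡n u≤v
... | g , refl = subst (λ z → L * z ≤ 6 * u) (sym (m+n∸m≡n u g))
  (+-cancelˡ-≤ (L * u) (L * g) (6 * u) (subst₂ _≤_ (*-distribˡ-+ L u g) (expand L u) lower))
  where
  expand : ∀ L u → u * (L + 6) ≡ L * u + 6 * u
  expand = solve-∀

within-gap : ∀ {L u v} → Within (L , L + 6) (u , v) → L * ℤ.∣ u ⊖ v ∣ ≤ 6 * v
within-gap {L} {u} {v} (within (*≤* lower) (*≤* upper)) with u ≤? v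
... | yes u≤v = subst (λ z → L * z ≤ 6 * v) (sym (∣⊖∣-≤ u≤v))
                  (≤-trans (gap-bound lower u≤v) (*-monoʳ-≤ 6 u≤v))
... | no u≰v  = subst (λ z → L * z ≤ 6 * v) (sym (trans (∣m⊖n∣≡∣n⊖m∣ u v) (∣⊖∣-≤ v≤u))) (gap-bound upper v≤u)
  where v≤u = <⇒≤ (≰⇒> u≰v)

-- The rational number represented by a fraction with positive denominator.
⟦_⟧ : Frac → ℚᵘ
⟦ a , b ⟧ = mkℚᵘ (+ a) (b ∸ 1)

⟦⟧-⊗ : ∀ x y → 0 < proj₂ x → 0 < proj₂ y → ⟦ x ⊗ y ⟧ ≃ ⟦ x ⟧ ℚᵘ.* ⟦ y ⟧
⟦⟧-⊗ (a , suc _) (c , suc _) _ _ = ≃-reflexive (cong (λ n → mkℚᵘ n _) (pos-* a c))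

toℚᵘ-/ : ∀ a b d → b ≡ suc d → toℚᵘ ((+ a) ℚ./ suc d) ≃ ⟦ a , b ⟧
toℚᵘ-/ a b d b≡1+d = ≃-trans (toℚᵘ-fromℚᵘ (mkℚᵘ (+ a) d)) (≃-reflexive (cong (mkℚᵘ (+ a) ∘ pred) (sym b≡1+d)))

toℚᵘ-factor : ∀ k → toℚᵘ (factor k) ≃ ⟦ F k ^± tm (suc k) ⟧
toℚᵘ-factor k with s₂ (suc k) % 2
... | zero  = toℚᵘ-/ _ _ _ (den k)
  where
  den : ∀ k → (4 * k + 5) * (2 * k + 1) ≡ suc ((4 * k + 4) * (2 * k + 1) + 2 * k)
  den = solve-∀
... | suc _ = toℚᵘ-/ _ _ _ (den k)
  where
  den : ∀ k → (4 * k + 3) * (2 * k + 3) ≡ suc ((4 * k + 2) * (2 * k + 3) + 2 * k + 2)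
  den = solve-∀

F-positive : ∀ k → Positive (F k)
F-positive k = positive-⊗ {e k} {G k} (Increasing.positive e-increasing k) (0<+suc (2 * k) 2 , 0<+suc (2 * k) 0)

toℚᵘ-partialProduct : ∀ M → toℚᵘ (partialProduct M) ≃ ⟦ signedProd F M ⟧
toℚᵘ-partialProduct zero    = ≃-refl
toℚᵘ-partialProduct (suc M) =
  ≃-trans (toℚᵘ-homo-* (partialProduct M) (factor M))
    (≃-trans (ℚᵘ.*-cong (toℚᵘ-partialProduct M) (toℚᵘ-factor M))
      (≃-sym (⟦⟧-⊗ (signedProd F M) (F M ^± tm (suc M))
                   (proj₂ (signedProd-positive F-positive M)) (proj₂ (positive-^± (tm (suc M)) {F M} (F-positive M))))))

½ᵘ : ℚᵘ
½ᵘ = mkℚᵘ (+ 1) 1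

toℚᵘ-distance : ∀ p → toℚᵘ ℚ.∣ p ℚ.- (+ 1) ℚ./ 2 ∣ ≃ ℚᵘ.∣ toℚᵘ p ℚᵘ.- ½ᵘ ∣
toℚᵘ-distance p = ≃-trans (toℚᵘ-homo-∣-∣ (p ℚ.- h))
  (∣-∣-cong (≃-trans (toℚᵘ-homo-+ p (ℚ.- h)) (ℚᵘ.+-cong (≃-refl {toℚᵘ p}) (toℚᵘ-homo‿- h))))
  where h = (+ 1) ℚ./ 2

distance-to-half : ∀ a b → 0 < b → ℚᵘ.∣ ⟦ a , b ⟧ ℚᵘ.- ½ᵘ ∣ ≃ mkℚᵘ (+ ℤ.∣ (2 * a) ⊖ b ∣) (b * 2 ∸ 1)
distance-to-half a (suc b) _ = ≃-reflexive (cong (λ z → mkℚᵘ (+ ℤ.∣ z ∣) _) (begin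
  + a ℤ.* + 2 ℤ.+ -[1+ 0 ] ℤ.* + suc b
    ≡⟨ cong₂ ℤ._+_ (trans (sym (pos-* a 2)) (cong +_ (*-comm a 2))) (-1*i≡-i (+ suc b)) ⟩
  + (2 * a) ℤ.- + suc b
    ≡⟨ m-n≡m⊖n (2 * a) (suc b) ⟩
  (2 * a) ⊖ suc b ∎))
  where open ≡-Reasoning

close-to-half : ∀ M x n d → 6 * suc d + 6 ≤ suc x → Within ((x , suc x) ^ᶠ 6) (two ⊗ signedProd F M) →
  toℚᵘ ℚ.∣ partialProduct M ℚ.- (+ 1) ℚ./ 2 ∣ ℚᵘ.< mkℚᵘ +[1+ n ] d
close-to-half M x n d x-large w = <-respˡ-≃ (≃-sym distance)
  (*<* (subst₂ ℤ._<_ (pos-* gap (suc d)) (pos-* (suc n) (suc (b * 2 ∸ 1))) (+<+ (scaled gap b b>0 gap-small))))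
  where
  a = proj₁ (signedProd F M)
  b = proj₂ (signedProd F M)
  b>0 = proj₂ (signedProd-positive F-positive M)
  gap = ℤ.∣ (2 * a) ⊖ b ∣
  L = suc x ∸ 6
  distance : toℚᵘ ℚ.∣ partialProduct M ℚ.- (+ 1) ℚ./ 2 ∣ ≃ mkℚᵘ (+ gap) (b * 2 ∸ 1)
  distance = ≃-trans (toℚᵘ-distance (partialProduct M))
    (≃-trans (∣-∣-cong (ℚᵘ.+-cong (toℚᵘ-partialProduct M) (≃-refl {ℚᵘ.- ½ᵘ}))) (distance-to-half a b b>0))
  within-L : Within (L , L + 6) (two ⊗ signedProd F M)
  within-L = subst (λ K → Within (L , K) (two ⊗ signedProd F M)) (sym (m∸n+n≡m (≤-trans (m≤n+m 6 (6 * suc d)) x-large)))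
    (within-weaken (bernoulli x 6) (^ᶠ-den>0 (x , suc x) (s≤s z≤n) 6) w)
  L-gap : L * gap ≤ 6 * b
  L-gap = subst (λ c → L * ℤ.∣ (2 * a) ⊖ c ∣ ≤ 6 * c) (*-identityˡ b) (within-gap within-L)
  L-large : 6 * suc d ≤ L
  L-large = subst (_≤ L) (m+n∸n≡m (6 * suc d) 6) (∸-monoˡ-≤ 6 x-large)
  gap-small : suc d * gap ≤ b
  gap-small = *-cancelˡ-≤ 6 (≤-trans (≤-reflexive (sym (*-assoc 6 (suc d) gap)))
                                      (≤-trans (*-monoˡ-≤ gap L-large) L-gap))
  scaled : ∀ g b → 0 < b → suc d * g ≤ b → g * suc d < suc n * suc (b * 2 ∸ 1)
  scaled g (suc b) _ dg≤b = begin-strict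
    g * suc d                      ≡⟨ *-comm g (suc d) ⟩
    suc d * g                      ≤⟨ dg≤b ⟩
    suc b                          <⟨ s≤s (s≤s (m≤m*n b 2)) ⟩
    suc (suc b * 2 ∸ 1)            ≤⟨ m≤n*m _ (suc n) ⟩
    suc n * suc (suc b * 2 ∸ 1)    ∎
    where open ≤-Reasoning

-- For ε = (n+1)/(d+1) take N₀ = 2(6(d+1)+6); every M ≥ N₀ is 2x+1 or 2x+2 with x large enough
-- (M = 0 is excluded by M ≥ N₀).
mainTheorem11 : (ε : ℚ) → 0ℚ ℚ.< ε →
    ∃ λ (N : ℕ) → (M : ℕ) → M ≥ N →
      ℚ.∣ partialProduct M ℚ.- (+ 1) ℚ./ 2 ∣ ℚ.< ε
mainTheorem11 (mkℚ (+ zero) d _) (ℚ.*<* (+<+ ()))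
mainTheorem11 (mkℚ -[1+ n ] d _) (ℚ.*<* ())
mainTheorem11 (mkℚ +[1+ n ] d _) _ = N₀ , λ M M≥N₀ → toℚᵘ-cancel-< (near-half M M≥N₀)
  where
  N₀ = (6 * suc d + 6) * 2
  large : ∀ {M} x → N₀ ≤ M → M ≤ suc x * 2 → 6 * suc d + 6 ≤ suc x
  large x N₀≤M M≤2x+2 = *-cancelʳ-≤ _ _ 2 (≤-trans N₀≤M M≤2x+2)
  near-half : ∀ M → M ≥ N₀ → toℚᵘ ℚ.∣ partialProduct M ℚ.- (+ 1) ℚ./ 2 ∣ ℚᵘ.< mkℚᵘ +[1+ n ] d
  near-half M M≥N₀ with parity M
  ... | even (suc x) = close-to-half (suc x * 2) x n d (large x M≥N₀ ≤-refl) (proj₂ (doubled-product-bound x))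
  ... | odd x        = close-to-half (suc (x * 2)) x n d (large x M≥N₀ (n≤1+n _)) (proj₁ (doubled-product-bound x))
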